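{- Let $G=(V,E)$ be a finite graph and $\overline G$ its complement graph. Then $\mathrm{c\text{ - }rk}\,\overline G$ equals the height of the lattice $\widetilde{\overline{\mathcal S}_V}=\{\bigcup\mathcal T\mid \mathcal T\subseteq\{\overline{\mathrm{St}}(v)\mid v\in V\}\}$ ordered by inclusion.
   Context: Graphs are finite, undirected, without loops or multiple edges. The complement $\overline G=(V,\overline E)$ has $\{v,w\}\in\overline E$ iff $v\neq w$ and $\{v,w\}\notin E$. $\mathrm{St}(v)$ is the set of neighbours of $v$ in $G$, and $\overline{\mathrm{St}}(v)=\mathrm{St}(v)\cup\{v\}$ is its closed star; the union of the empty family is $\emptyset$. The height of a finite poset is the maximum $k$ such that it has a chain $p_0<\dots<p_k$. For a graph $H=(U,F)$, $\mathrm{c\text{ - }rk}\,H$ is the maximum number of independent columns of the $U\times U$ boolean matrix $A^c_H$ (entry $0$ if $\{i,j\}\in F$, else $1$), where vectors over the superboolean semiring $\{0,1,1^\nu\}$ (with $0+x=x$, $1+1=1^\nu$, $1^\nu+x=1^\nu$, $0\cdot x=0$, $1\cdot1=1$, $1\cdot1^\nu=1^\nu\cdot1^\nu=1^\nu$) are dependent if some $\{0,1\}$-combination, not all coefficients zero, has all coordinates in $\{0,1^\nu\}$, and independent otherwise. -}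

module Defs where

open import Data.Nat using (ℕ; suc; _≤_)
open import Data.Bool using (Bool; true; false; not; _∧_; if_then_else_)
open import Data.Fin using (Fin; zero; suc; inject₁; _≟_)
open import Data.Fin.Subset using (Subset; _∈_; _⊂_; ⋃; _∪_; ⁅_⁆; ∣_∣)
open import Data.Vec using (tabulate)
open import Data.List using (List; map)
open import Data.Product using (Σ; ∃; _×_)
open import Relation.Nullary using (¬_; does)
open import Relation.Binary.PropositionalEquality using (_≡_; _≢_; refl)
open import Data.Bool.Properties using (∧-comm)

record Graph (n : ℕ) : Set where
  field
    adj    : Fin n → Fin n → Bool
    sym    : ∀ i j → adj i j ≡ adj j i
    irrefl : ∀ i → adj i i ≡ false
open Graph public

private
  eqb : ∀ {n} → Fin n → Fin n → Bool
  eqb i j = does (i ≟ j)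

  eqb-sym : ∀ {n} (i j : Fin n) → eqb i j ≡ eqb j i
  eqb-sym i j with i ≟ j | j ≟ i
  ... | Relation.Nullary.yes _ | Relation.Nullary.yes _ = refl
  ... | Relation.Nullary.no _  | Relation.Nullary.no _  = refl
  ... | Relation.Nullary.yes refl | Relation.Nullary.no ¬p = Data.Empty.⊥-elim (¬p refl)
    where import Data.Empty
  ... | Relation.Nullary.no ¬p | Relation.Nullary.yes refl = Data.Empty.⊥-elim (¬p refl)
    where import Data.Empty

  eqb-refl : ∀ {n} (i : Fin n) → eqb i i ≡ true
  eqb-refl i with i ≟ i
  ... | Relation.Nullary.yes _ = refl
  ... | Relation.Nullary.no ¬p = Data.Empty.⊥-elim (¬p refl)
    where import Data.Empty

complement : ∀ {n} → Graph n → Graph n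
complement G = record
  { adj    = λ i j → not (eqb i j) ∧ not (adj G i j)
  ; sym    = λ i j → prf i j
  ; irrefl = λ i → irr i
  }
  where
  open import Relation.Binary.PropositionalEquality using (cong₂)
  prf : ∀ i j → (not (eqb i j) ∧ not (adj G i j)) ≡ (not (eqb j i) ∧ not (adj G j i))
  prf i j = cong₂ (λ a b → not a ∧ not b) (eqb-sym i j) (sym G i j)
  irr : ∀ i → (not (eqb i i) ∧ not (adj G i i)) ≡ false
  irr i rewrite eqb-refl i = refl

St : ∀ {n} → Graph n → Fin n → Subset n
St G v = tabulate (λ w → adj G v w)

closedSt : ∀ {n} → Graph n → Fin n → Subset n
closedSt G v = St G v ∪ ⁅ v ⁆

-- The lattice of unions of closed stars: X belongs to it iff X = ⋃ 𝒯 for a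
-- subfamily 𝒯 of {St̄(v) | v ∈ V}; 𝒯 is given by a list of vertices
-- (the empty list gives ⋃ ∅ = ∅).
InUnionLattice : ∀ {n} → Graph n → Subset n → Set
InUnionLattice G X = Σ (List (Fin _)) (λ vs → X ≡ ⋃ (map (closedSt G) vs))

record Chain {n} (G : Graph n) (k : ℕ) : Set where
  field
    elem    : Fin (suc k) → Subset n
    inL     : ∀ i → InUnionLattice G (elem i)
    strict  : ∀ (i : Fin k) → elem (inject₁ i) ⊂ elem (suc i)

IsHeightUnionLattice : ∀ {n} → Graph n → ℕ → Set
IsHeightUnionLattice G k = Chain G k × (∀ m → Chain G m → m ≤ k)

data SB : Set where
  𝟘 𝟙 𝟙ᵛ : SB

_⊕_ : SB → SB → SB
𝟘  ⊕ x  = x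
𝟙  ⊕ 𝟘  = 𝟙
𝟙  ⊕ 𝟙  = 𝟙ᵛ
𝟙  ⊕ 𝟙ᵛ = 𝟙ᵛ
𝟙ᵛ ⊕ x  = 𝟙ᵛ

_⊙_ : SB → SB → SB
𝟘  ⊙ x  = 𝟘
𝟙  ⊙ 𝟘  = 𝟘
𝟙  ⊙ 𝟙  = 𝟙
𝟙  ⊙ 𝟙ᵛ = 𝟙ᵛ
𝟙ᵛ ⊙ 𝟘  = 𝟘
𝟙ᵛ ⊙ 𝟙  = 𝟙ᵛ
𝟙ᵛ ⊙ 𝟙ᵛ = 𝟙ᵛ

sumSB : ∀ {m} → (Fin m → SB) → SB
sumSB {ℕ.zero} f = 𝟘
sumSB {suc m}  f = f zero ⊕ sumSB (λ i → f (suc i))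

coeff : Bool → SB
coeff false = 𝟘
coeff true  = 𝟙

Ac : ∀ {n} → Graph n → Fin n → Fin n → SB
Ac H i j = if adj H i j then 𝟘 else 𝟙

DependentCols : ∀ {n} → Graph n → Subset n → Set
DependentCols {n} H S =
  Σ (Fin n → Bool) λ c →
    (∀ j → c j ≡ true → j ∈ S) ×
    (∃ λ j → c j ≡ true) ×
    (∀ i → sumSB (λ j → coeff (c j) ⊙ Ac H i j) ≢ 𝟙)

IndependentCols : ∀ {n} → Graph n → Subset n → Set
IndependentCols H S = ¬ DependentCols H S

IsCRk : ∀ {n} → Graph n → ℕ → Set
IsCRk H k = (∃ λ S → IndependentCols H S × ∣ S ∣ ≡ k)
          × (∀ S → IndependentCols H S → ∣ S ∣ ≤ k)

-- Column j of the matrix A^c of the complement Ḡ is the indicator vector of the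
-- closed star St̄(j): entry (i, j) is 1 iff i = j or {i, j} ∈ E.  Both sides of the
-- theorem are then governed by one combinatorial object, a *triangular sequence*
-- of pivots (j₁, x₁), …, (j_k, x_k): x_t ∈ St̄(j_t), and x_s ∉ St̄(j_t) for s > t.
--
--  * A chain B₀ ⊂ … ⊂ B_k of unions of stars yields one (x_t ∈ B_t ∖ B_{t-1} and
--    j_t any star inside B_t containing x_t), and conversely the sets
--    B ∪ St̄(j₁) ∪ … ∪ St̄(j_t) form a chain of length k.
--  * The columns j₁, …, j_k of a triangular sequence are independent: in any
--    nonzero {0,1}-combination the pivot row of the last selected column sums to 1.
--    Conversely an independent set S has a row covered by exactly one star of S
--    (else the all-ones combination on S is dependent); removing that column and
--    recursing builds a triangular sequence with column set S.
--
-- Hence independent sets of columns and chains have the same possible sizes; the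
-- maximum independent set exists by a bounded search, and the theorem follows.
module Submission where

open import Defs hiding (sym)
open import Defs using () renaming (sym to adj-sym)
open import Data.Nat using (ℕ; zero; suc; _≤_; _+_)
import Data.Nat as ℕ
open import Data.Nat.Properties using (≤∧≢⇒<; +-comm; ≤-pred; 0≢1+n)
open import Data.Bool using (Bool; true; false; not; _∧_; if_then_else_)
open import Data.Bool.Properties using (∧-zeroʳ) renaming (_≟_ to _≟ᴮ_)
open import Data.Fin using (Fin; zero; suc; inject₁; _≟_)
open import Data.Fin.Properties using (¬∀⟶∃¬; suc-injective) renaming (any? to anyFin?; all? to allFin?)
open import Data.Fin.Subset
  using (Subset; _∈_; _∉_; _⊆_; _⊂_; ⋃; _∪_; ⁅_⁆; ∣_∣; ⊥; _-_; _─_; Nonempty)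
open import Data.Fin.Subset.Properties
  using (_∈?_; x∈p∪q⁻; x∈p∪q⁺; p⊆p∪q; q⊆p∪q; x∈⁅x⁆; x∈⁅y⁆⇒x≡y; x∉⁅y⁆⇒x≢y; ∉⊥; ∣⊥∣≡0;
         ∣p∣≤n; p─⊥≡p; p─q⊆p; ∪-identityˡ; anySubset?; nonempty?; Empty-unique)
open import Data.Vec using (_∷_; tabulate; lookup; here; there)
open import Data.Vec.Properties using ([]=⇒lookup; lookup⇒[]=; lookup∘tabulate)
open import Data.List using (List; []; _∷_; map; length; _++_)
open import Data.List.Properties using (length-++)
open import Data.List.Relation.Unary.All using (All; []; _∷_)
import Data.List.Relation.Unary.All as All
open import Data.List.Relation.Unary.All.Properties using (++⁺)
open import Data.List.Relation.Unary.Any using (Any; here; there)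
import Data.List.Relation.Unary.Any as Any
open import Data.Product using (Σ; ∃; _×_; _,_; proj₁; proj₂)
open import Data.Sum using (_⊎_; inj₁; inj₂)
open import Data.Unit using (⊤; tt)
open import Data.Empty using (⊥-elim)
open import Function using (_∘_)
open import Relation.Nullary using (¬_; Dec; yes; no; does)
open import Relation.Nullary.Decidable using (_×-dec_; _→-dec_; ¬?; decidable-stable)
open import Relation.Binary.PropositionalEquality
  using (_≡_; _≢_; refl; sym; trans; cong; cong₂; subst)

private
  variable
    n k : ℕ

_≟SB_ : (a b : SB) → Dec (a ≡ b)
𝟘  ≟SB 𝟘  = yes refl
𝟙  ≟SB 𝟙  = yes refl
𝟙ᵛ ≟SB 𝟙ᵛ = yes refl
𝟘  ≟SB 𝟙  = no λ ()
𝟘  ≟SB 𝟙ᵛ = no λ ()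
𝟙  ≟SB 𝟘  = no λ ()
𝟙  ≟SB 𝟙ᵛ = no λ ()
𝟙ᵛ ≟SB 𝟘  = no λ ()
𝟙ᵛ ≟SB 𝟙  = no λ ()

⊕≡𝟘⁻ : ∀ a b → a ⊕ b ≡ 𝟘 → a ≡ 𝟘 × b ≡ 𝟘
⊕≡𝟘⁻ 𝟘 b e = refl , e
⊕≡𝟘⁻ 𝟙 𝟘 ()
⊕≡𝟘⁻ 𝟙 𝟙 ()
⊕≡𝟘⁻ 𝟙 𝟙ᵛ ()

⊕≡𝟙⁻ : ∀ a b → a ⊕ b ≡ 𝟙 → (a ≡ 𝟘 × b ≡ 𝟙) ⊎ (a ≡ 𝟙 × b ≡ 𝟘)
⊕≡𝟙⁻ 𝟘 b e = inj₁ (refl , e)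
⊕≡𝟙⁻ 𝟙 𝟘 _ = inj₂ (refl , refl)
⊕≡𝟙⁻ 𝟙 𝟙 ()
⊕≡𝟙⁻ 𝟙 𝟙ᵛ ()

coeff⊙≡𝟙⁻ : ∀ b a → coeff b ⊙ a ≡ 𝟙 → b ≡ true × a ≡ 𝟙
coeff⊙≡𝟙⁻ true 𝟙 refl = refl , refl
coeff⊙≡𝟙⁻ true 𝟘 ()
coeff⊙≡𝟙⁻ true 𝟙ᵛ ()

sumSB-cong : ∀ {m} (f g : Fin m → SB) → (∀ j → f j ≡ g j) → sumSB f ≡ sumSB g
sumSB-cong {zero}  f g e = refl
sumSB-cong {suc m} f g e = cong₂ _⊕_ (e zero) (sumSB-cong (f ∘ suc) (g ∘ suc) (e ∘ suc))

sumSB≡𝟘 : ∀ {m} (f : Fin m → SB) → (∀ j → f j ≡ 𝟘) → sumSB f ≡ 𝟘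
sumSB≡𝟘 {zero}  f e = refl
sumSB≡𝟘 {suc m} f e = cong₂ _⊕_ (e zero) (sumSB≡𝟘 (f ∘ suc) (e ∘ suc))

sumSB≡𝟘⁻ : ∀ {m} (f : Fin m → SB) → sumSB f ≡ 𝟘 → ∀ j → f j ≡ 𝟘
sumSB≡𝟘⁻ f e zero    = proj₁ (⊕≡𝟘⁻ _ _ e)
sumSB≡𝟘⁻ f e (suc j) = sumSB≡𝟘⁻ (f ∘ suc) (proj₂ (⊕≡𝟘⁻ _ _ e)) j

sumSB≡𝟙 : ∀ {m} (f : Fin m → SB) (j₀ : Fin m) → f j₀ ≡ 𝟙 → (∀ j → j ≢ j₀ → f j ≡ 𝟘) →
          sumSB f ≡ 𝟙
sumSB≡𝟙 f zero     e others =
  cong₂ _⊕_ e (sumSB≡𝟘 (f ∘ suc) (λ j → others (suc j) λ ()))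
sumSB≡𝟙 f (suc j₀) e others =
  cong₂ _⊕_ (others zero λ ()) (sumSB≡𝟙 (f ∘ suc) j₀ e (λ j j≢ → others (suc j) (j≢ ∘ suc-injective)))

sumSB≡𝟙⁻ : ∀ {m} (f : Fin m → SB) → sumSB f ≡ 𝟙 →
           Σ (Fin m) λ j₀ → f j₀ ≡ 𝟙 × (∀ j → j ≢ j₀ → f j ≡ 𝟘)
sumSB≡𝟙⁻ {zero}  f ()
sumSB≡𝟙⁻ {suc m} f e with ⊕≡𝟙⁻ (f zero) (sumSB (f ∘ suc)) e
... | inj₂ (head≡𝟙 , tail≡𝟘) =
  zero , head≡𝟙 , λ { zero ne → ⊥-elim (ne refl) ; (suc j) _ → sumSB≡𝟘⁻ (f ∘ suc) tail≡𝟘 j }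
... | inj₁ (head≡𝟘 , tail≡𝟙) with sumSB≡𝟙⁻ (f ∘ suc) tail≡𝟙
...   | j₀ , f≡𝟙 , others = suc j₀ , f≡𝟙 , λ { zero _ → head≡𝟘 ; (suc j) ne → others j (ne ∘ cong suc) }

boundedMax : (P : ℕ → Set) → (∀ m → Dec (P m)) → P 0 → ∀ b → (∀ m → P m → m ≤ b) →
             Σ ℕ λ k → P k × (∀ m → P m → m ≤ k)
boundedMax P P? p₀ zero    bound = 0 , p₀ , bound
boundedMax P P? p₀ (suc b) bound with P? (suc b)
... | yes p = suc b , p , bound
... | no ¬p = boundedMax P P? p₀ b
  (λ m pm → ≤-pred (≤∧≢⇒< (bound m pm) (λ m≡ → ¬p (subst P m≡ pm))))

x∉p∪q : ∀ {x : Fin n} p q → x ∉ p → x ∉ q → x ∉ p ∪ q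
x∉p∪q p q x∉p x∉q x∈ with x∈p∪q⁻ p q x∈
... | inj₁ x∈p = x∉p x∈p
... | inj₂ x∈q = x∉q x∈q

x∈p─q⇒x∉q : ∀ {x : Fin n} p q → x ∈ p ─ q → x ∉ q
x∈p─q⇒x∉q (_ ∷ p) (true ∷ q) ()        here
x∈p─q⇒x∉q (_ ∷ p) (_ ∷ q)    (there h) (there h') = x∈p─q⇒x∉q p q h h'

∣p∣≡1+∣p-x∣ : ∀ {p : Subset n} {x} → x ∈ p → ∣ p ∣ ≡ suc ∣ p - x ∣
∣p∣≡1+∣p-x∣ {p = true ∷ p}  here      = cong (suc ∘ ∣_∣) (sym (p─⊥≡p p))
∣p∣≡1+∣p-x∣ {p = true ∷ p}  (there h) = cong suc (∣p∣≡1+∣p-x∣ h)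
∣p∣≡1+∣p-x∣ {p = false ∷ p} (there h) = ∣p∣≡1+∣p-x∣ h

∣⁅x⁆∪p∣≡1+∣p∣ : ∀ (x : Fin n) p → x ∉ p → ∣ ⁅ x ⁆ ∪ p ∣ ≡ suc ∣ p ∣
∣⁅x⁆∪p∣≡1+∣p∣ zero    (true ∷ p)  x∉ = ⊥-elim (x∉ here)
∣⁅x⁆∪p∣≡1+∣p∣ zero    (false ∷ p) x∉ = cong (suc ∘ ∣_∣) (∪-identityˡ p)
∣⁅x⁆∪p∣≡1+∣p∣ (suc x) (true ∷ p)  x∉ = cong suc (∣⁅x⁆∪p∣≡1+∣p∣ x p (x∉ ∘ there))
∣⁅x⁆∪p∣≡1+∣p∣ (suc x) (false ∷ p) x∉ = ∣⁅x⁆∪p∣≡1+∣p∣ x p (x∉ ∘ there)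

∣p∣≡1+m⇒nonempty : ∀ (p : Subset n) {m} → ∣ p ∣ ≡ suc m → Nonempty p
∣p∣≡1+m⇒nonempty {n} p e with nonempty? p
... | yes ne = ne
... | no ¬ne = ⊥-elim (0≢1+n (trans (sym (∣⊥∣≡0 n)) (trans (cong ∣_∣ (sym (Empty-unique ¬ne))) e)))

DependentVia : Graph n → Subset n → (Fin n → Bool) → Set
DependentVia H S c = (∀ j → c j ≡ true → j ∈ S) × (∃ λ j → c j ≡ true) ×
                     (∀ i → sumSB (λ j → coeff (c j) ⊙ Ac H i j) ≢ 𝟙)

dependentVia? : ∀ (H : Graph n) S c → Dec (DependentVia H S c)
dependentVia? H S c =
  allFin? (λ j → (c j ≟ᴮ true) →-dec (j ∈? S)) ×-dec
  anyFin? (λ j → c j ≟ᴮ true) ×-dec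
  allFin? (λ i → ¬? (sumSB (λ j → coeff (c j) ⊙ Ac H i j) ≟SB 𝟙))

-- the witness only depends on c pointwise (needed since c is a function)
dependentVia-ext : ∀ (H : Graph n) S c c′ → (∀ j → c j ≡ c′ j) →
                   DependentVia H S c → DependentVia H S c′
dependentVia-ext H S c c′ c≗c′ (c⊆S , (j , cj) , noRow𝟙) =
  (λ j c′j → c⊆S j (trans (c≗c′ j) c′j)) , (j , trans (sym (c≗c′ j)) cj) ,
  (λ i → noRow𝟙 i ∘ trans (sumSB-cong _ _ λ j → cong (λ b → coeff b ⊙ Ac H i j) (c≗c′ j)))

dependentCols? : ∀ (H : Graph n) S → Dec (DependentCols H S)
dependentCols? H S with anySubset? (λ v → dependentVia? H S (lookup v))
... | yes (v , dep) = yes (lookup v , dep)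
... | no ¬dep = no λ (c , dep) →
  ¬dep (tabulate c , dependentVia-ext H S c _ (λ j → sym (lookup∘tabulate c j)) dep)

dependent-mono : ∀ {H : Graph n} {S S′} → S′ ⊆ S → DependentCols H S′ → DependentCols H S
dependent-mono S′⊆S (c , c⊆S′ , nonzero , noRow𝟙) = c , (λ j → S′⊆S ∘ c⊆S′ j) , nonzero , noRow𝟙

c-rk-exists : ∀ (H : Graph n) → Σ ℕ (IsCRk H)
c-rk-exists {n} H with boundedMax Size size? emptyIndependent n (λ m (S , _ , e) → subst (_≤ n) e (∣p∣≤n S))
  where
  Size : ℕ → Set
  Size m = ∃ λ S → IndependentCols H S × ∣ S ∣ ≡ m
  size? : ∀ m → Dec (Size m)
  size? m = anySubset? (λ S → ¬? (dependentCols? H S) ×-dec (∣ S ∣ ℕ.≟ m))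
  emptyIndependent : Size 0
  emptyIndependent = ⊥ , (λ (c , c⊆⊥ , (j , cj) , _) → ∉⊥ (c⊆⊥ j cj)) , ∣⊥∣≡0 n
... | k , largest , maximal = k , largest , λ S ind → maximal ∣ S ∣ (S , ind , refl)

module _ {n : ℕ} (G : Graph n) where

  private
    Ḡ : Graph n
    Ḡ = complement G

    star : Fin n → Subset n
    star = closedSt G

  ∈star⇒nonadjacent : ∀ {i j} → i ∈ star j → adj Ḡ i j ≡ false
  ∈star⇒nonadjacent {i} {j} i∈ with x∈p∪q⁻ (St G j) ⁅ j ⁆ i∈
  ... | inj₂ i∈⁅j⁆ rewrite x∈⁅y⁆⇒x≡y j i∈⁅j⁆ = irrefl Ḡ j
  ... | inj₁ i∈St = subst (λ b → not (does (i ≟ j)) ∧ not b ≡ false) (sym adjacent)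
                          (∧-zeroʳ (not (does (i ≟ j))))
    where
    adjacent : adj G i j ≡ true
    adjacent = trans (adj-sym G i j) (trans (sym (lookup∘tabulate (adj G j) i)) ([]=⇒lookup i∈St))

  nonadjacent⇒∈star : ∀ {i j} → adj Ḡ i j ≡ false → i ∈ star j
  nonadjacent⇒∈star {i} {j} nonadj with i ≟ j | adj G i j in adjacent
  ... | yes refl | _    = x∈p∪q⁺ {p = St G i} (inj₂ (x∈⁅x⁆ i))
  ... | no _     | true = x∈p∪q⁺ {q = ⁅ j ⁆} (inj₁ (lookup⇒[]= i (St G j)
      (trans (lookup∘tabulate (adj G j) i) (trans (sym (adj-sym G i j)) adjacent))))

  entry≡𝟙 : ∀ {i j} → i ∈ star j → Ac Ḡ i j ≡ 𝟙
  entry≡𝟙 i∈ = cong (if_then 𝟘 else 𝟙) (∈star⇒nonadjacent i∈)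

  entry≡𝟙⁻ : ∀ {i j} → Ac Ḡ i j ≡ 𝟙 → i ∈ star j
  entry≡𝟙⁻ {i} {j} e with adj Ḡ i j in nonadj
  ... | false = nonadjacent⇒∈star nonadj

  entry≡𝟘 : ∀ {i j} → i ∉ star j → Ac Ḡ i j ≡ 𝟘
  entry≡𝟘 {i} {j} i∉ with adj Ḡ i j in nonadj
  ... | true  = refl
  ... | false = ⊥-elim (i∉ (nonadjacent⇒∈star nonadj))

  CoveredOnceBy : (Fin n → Bool) → Fin n → Fin n → Set
  CoveredOnceBy c i j₀ = c j₀ ≡ true × i ∈ star j₀ × (∀ j → c j ≡ true → i ∈ star j → j ≡ j₀)

  rowSum : (Fin n → Bool) → Fin n → SB
  rowSum c i = sumSB (λ j → coeff (c j) ⊙ Ac Ḡ i j)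

  selectedTerm≡𝟙 : ∀ (c : Fin n → Bool) {i j} → c j ≡ true → i ∈ star j → coeff (c j) ⊙ Ac Ḡ i j ≡ 𝟙
  selectedTerm≡𝟙 c cj i∈ = cong₂ (λ b a → coeff b ⊙ a) cj (entry≡𝟙 i∈)

  coveredOnce⇒rowSum≡𝟙 : ∀ {c i j₀} → CoveredOnceBy c i j₀ → rowSum c i ≡ 𝟙
  coveredOnce⇒rowSum≡𝟙 {c} {i} {j₀} (cj₀ , i∈j₀ , unique) =
    sumSB≡𝟙 _ j₀ (selectedTerm≡𝟙 c cj₀ i∈j₀) otherTerm≡𝟘
    where
    otherTerm≡𝟘 : ∀ j → j ≢ j₀ → coeff (c j) ⊙ Ac Ḡ i j ≡ 𝟘
    otherTerm≡𝟘 j j≢j₀ with c j in cj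
    ... | false = refl
    ... | true with i ∈? star j
    ...   | yes i∈j = ⊥-elim (j≢j₀ (unique j cj i∈j))
    ...   | no  i∉j = cong (𝟙 ⊙_) (entry≡𝟘 i∉j)

  rowSum≡𝟙⇒coveredOnce : ∀ {c i} → rowSum c i ≡ 𝟙 → ∃ (CoveredOnceBy c i)
  rowSum≡𝟙⇒coveredOnce {c} {i} e with sumSB≡𝟙⁻ _ e
  ... | j₀ , term≡𝟙 , others≡𝟘 with coeff⊙≡𝟙⁻ (c j₀) _ term≡𝟙
  ...   | cj₀ , entry = j₀ , cj₀ , entry≡𝟙⁻ entry , unique
    where
    unique : ∀ j → c j ≡ true → i ∈ star j → j ≡ j₀
    unique j cj i∈j with j ≟ j₀
    ... | yes j≡j₀ = j≡j₀
    ... | no  j≢j₀ with trans (sym (selectedTerm≡𝟙 c cj i∈j)) (others≡𝟘 j j≢j₀)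
    ...   | ()

  record Pivot : Set where
    constructor pivot
    field
      col row : Fin n
  open Pivot

  RowsAvoid : Subset n → List Pivot → Set
  RowsAvoid X = All (λ p → row p ∉ X)

  Triangular : List Pivot → Set
  Triangular []               = ⊤
  Triangular (pivot j x ∷ ps) = x ∈ star j × RowsAvoid (star j) ps × Triangular ps

  snoc-triangular : ∀ ps {j x} → Triangular ps → x ∈ star j →
                    All (λ p → x ∉ star (col p)) ps → Triangular (ps ++ pivot j x ∷ [])
  snoc-triangular []       _                  x∈j []         = x∈j , [] , tt
  snoc-triangular (_ ∷ ps) (x∈ , avoid , tri) x∈j (x∉ ∷ x∉s) =
    x∈ , ++⁺ avoid (x∉ ∷ []) , snoc-triangular ps tri x∈j x∉s

  bottom : Chain G k → Subset n
  bottom C = Chain.elem C zero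

  dropBottom : Chain G (suc k) → Chain G k
  dropBottom C = record
    { elem = Chain.elem C ∘ suc ; inL = Chain.inL C ∘ suc ; strict = Chain.strict C ∘ suc }

  extendBelow : ∀ B → InUnionLattice G B → (C : Chain G k) → B ⊂ bottom C → Chain G (suc k)
  extendBelow {k} B B∈L C B⊂ = record { elem = elem ; inL = inL ; strict = strict }
    where
    elem : Fin (suc (suc k)) → Subset n
    elem zero    = B
    elem (suc i) = Chain.elem C i
    inL : ∀ i → InUnionLattice G (elem i)
    inL zero    = B∈L
    inL (suc i) = Chain.inL C i
    strict : ∀ i → elem (inject₁ i) ⊂ elem (suc i)
    strict zero    = B⊂
    strict (suc i) = Chain.strict C i

  ∈⋃stars : ∀ vs {x} → x ∈ ⋃ (map star vs) → Σ (Fin n) λ j → x ∈ star j × star j ⊆ ⋃ (map star vs)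
  ∈⋃stars []       x∈ = ⊥-elim (∉⊥ x∈)
  ∈⋃stars (v ∷ vs) x∈ with x∈p∪q⁻ (star v) (⋃ (map star vs)) x∈
  ... | inj₁ x∈v = v , x∈v , p⊆p∪q (⋃ (map star vs))
  ... | inj₂ x∈⋃ with ∈⋃stars vs x∈⋃
  ...   | j , x∈j , j⊆ = j , x∈j , q⊆p∪q (star v) _ ∘ j⊆

  -- B_t ∖ B_{t-1} contains a pivot row x_t, and some star St̄(j_t) ⊆ B_t contains it.
  chain⇒triangular : (C : Chain G k) →
    Σ (List Pivot) λ ps → Triangular ps × length ps ≡ k × RowsAvoid (bottom C) ps
  chain⇒triangular {zero}  C = [] , tt , refl , []
  chain⇒triangular {suc k} C
    with chain⇒triangular (dropBottom C) | Chain.strict C zero | Chain.inL C (suc zero)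
  ... | ps , tri , len , avoid | B₀⊆B₁ , x , x∈B₁ , x∉B₀ | vs , B₁≡ with ∈⋃stars vs (subst (x ∈_) B₁≡ x∈B₁)
  ...   | j , x∈j , j⊆⋃ =
    pivot j x ∷ ps ,
    (x∈j , All.map (λ y∉B₁ → y∉B₁ ∘ j⊆B₁) avoid , tri) ,
    cong suc len ,
    x∉B₀ ∷ All.map (λ y∉B₁ → y∉B₁ ∘ B₀⊆B₁) avoid
    where
    j⊆B₁ : star j ⊆ Chain.elem C (suc zero)
    j⊆B₁ y∈j = subst (_ ∈_) (sym B₁≡) (j⊆⋃ y∈j)

  -- B ⊂ B ∪ St̄(j₁) ⊂ B ∪ St̄(j₁) ∪ St̄(j₂) ⊂ …, strict thanks to the pivot rows.
  triangular⇒chain : ∀ ps → Triangular ps → ∀ B → InUnionLattice G B → RowsAvoid B ps →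
                     Σ (Chain G (length ps)) λ C → bottom C ≡ B
  triangular⇒chain [] _ B B∈L _ =
    record { elem = λ _ → B ; inL = λ _ → B∈L ; strict = λ () } , refl
  triangular⇒chain (pivot j x ∷ ps) (x∈j , avoid-j , tri) B (vs , B≡) (x∉B ∷ avoid-B)
    with triangular⇒chain ps tri (star j ∪ B) (j ∷ vs , cong (star j ∪_) B≡)
           (All.zipWith (λ (y∉j , y∉B) → x∉p∪q (star j) B y∉j y∉B) (avoid-j , avoid-B))
  ... | C , bottom≡ =
    extendBelow B (vs , B≡) C
      (subst (B ⊂_) (sym bottom≡) (q⊆p∪q (star j) B , x , x∈p∪q⁺ (inj₁ x∈j) , x∉B)) , refl

  columns : List Pivot → Subset n
  columns []               = ⊥
  columns (pivot j _ ∷ ps) = ⁅ j ⁆ ∪ columns ps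

  _∈cols_ : Fin n → List Pivot → Set
  j ∈cols ps = Any (λ p → j ≡ col p) ps

  ∈columns⁻ : ∀ ps {j} → j ∈ columns ps → j ∈cols ps
  ∈columns⁻ []                j∈ = ⊥-elim (∉⊥ j∈)
  ∈columns⁻ (pivot j′ _ ∷ ps) j∈ with x∈p∪q⁻ ⁅ j′ ⁆ (columns ps) j∈
  ... | inj₁ j∈⁅j′⁆ = here (x∈⁅y⁆⇒x≡y j′ j∈⁅j′⁆)
  ... | inj₂ j∈cs   = there (∈columns⁻ ps j∈cs)

  columns-fresh : ∀ ps {j} → Triangular ps → RowsAvoid (star j) ps → j ∉ columns ps
  columns-fresh ps tri avoid j∈ = notAmong ps tri avoid (∈columns⁻ ps j∈)
    where
    notAmong : ∀ ps {j} → Triangular ps → RowsAvoid (star j) ps → ¬ (j ∈cols ps)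
    notAmong (_ ∷ ps) (x∈ , _ , _)  (x∉ ∷ _)    (here refl) = x∉ x∈
    notAmong (_ ∷ ps) (_ , _ , tri) (_ ∷ avoid) (there j∈)  = notAmong ps tri avoid j∈

  -- the columns of a triangular sequence are pairwise distinct
  ∣columns∣≡length : ∀ ps → Triangular ps → ∣ columns ps ∣ ≡ length ps
  ∣columns∣≡length []               _                 = ∣⊥∣≡0 n
  ∣columns∣≡length (pivot j _ ∷ ps) (_ , avoid , tri) =
    trans (∣⁅x⁆∪p∣≡1+∣p∣ j (columns ps) (columns-fresh ps tri avoid))
          (cong suc (∣columns∣≡length ps tri))

  -- The pivot row of the last selected column is covered exactly once.  Invariant:
  -- each selected column is a remaining column or its star avoids all remaining rows.
  lastPivotRow : ∀ ps → Triangular ps → (c : Fin n → Bool) →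
    (∀ j → c j ≡ true → j ∈cols ps ⊎ RowsAvoid (star j) ps) →
    Any (λ p → c (col p) ≡ true) ps → ∃ λ i → ∃ (CoveredOnceBy c i)
  lastPivotRow (pivot j x ∷ ps) (x∈j , avoid , tri) c selected some
    with Any.any? (λ p → c (col p) ≟ᴮ true) ps
  ... | yes later = lastPivotRow ps tri c selected′ later
    where
    selected′ : ∀ j′ → c j′ ≡ true → j′ ∈cols ps ⊎ RowsAvoid (star j′) ps
    selected′ j′ cj′ with selected j′ cj′
    ... | inj₁ (here refl)   = inj₂ avoid
    ... | inj₁ (there j′∈)  = inj₁ j′∈
    ... | inj₂ (_ ∷ avoid′) = inj₂ avoid′
  ... | no ¬later = x , j , thisSelected some , x∈j , unique
    where
    thisSelected : Any (λ p → c (col p) ≡ true) (pivot j x ∷ ps) → c j ≡ true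
    thisSelected (here cj)     = cj
    thisSelected (there later) = ⊥-elim (¬later later)
    unique : ∀ j′ → c j′ ≡ true → x ∈ star j′ → j′ ≡ j
    unique j′ cj′ x∈j′ with selected j′ cj′
    ... | inj₁ (here j′≡j)  = j′≡j
    ... | inj₁ (there j′∈) = ⊥-elim (¬later (Any.map (λ j′≡ → subst (λ z → c z ≡ true) j′≡ cj′) j′∈))
    ... | inj₂ (x∉j′ ∷ _)  = ⊥-elim (x∉j′ x∈j′)

  triangular⇒independent : ∀ ps → Triangular ps → IndependentCols Ḡ (columns ps)
  triangular⇒independent ps tri (c , c⊆ , (j₁ , cj₁) , noRow𝟙)
    with lastPivotRow ps tri c (λ j cj → inj₁ (∈columns⁻ ps (c⊆ j cj)))
           (Any.map (λ j₁≡ → subst (λ z → c z ≡ true) j₁≡ cj₁) (∈columns⁻ ps (c⊆ j₁ cj₁)))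
  ... | i , j₀ , covered = noRow𝟙 i (coveredOnce⇒rowSum≡𝟙 covered)

  -- An independent nonempty S has a row covered by exactly one star of S: otherwise
  -- the all-ones combination on S would witness dependence.
  coveredOnceRow : ∀ S → IndependentCols Ḡ S → Nonempty S → ∃ λ i → ∃ (CoveredOnceBy (lookup S) i)
  coveredOnceRow S ind (j₁ , j₁∈S)
    with ¬∀⟶∃¬ n _ (λ i → ¬? (rowSum (lookup S) i ≟SB 𝟙)) notAllRows
    where
    notAllRows : ¬ (∀ i → rowSum (lookup S) i ≢ 𝟙)
    notAllRows noRow𝟙 = ind (lookup S , (λ j → lookup⇒[]= j S) , (j₁ , []=⇒lookup j₁∈S) , noRow𝟙)
  ... | i , ¬≢𝟙 = i , rowSum≡𝟙⇒coveredOnce (decidable-stable (_ ≟SB 𝟙) ¬≢𝟙)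

  -- Remove the column covering that row once, recurse, and append its pivot last.
  independent⇒triangular : ∀ m S → IndependentCols Ḡ S → ∣ S ∣ ≡ m →
    Σ (List Pivot) λ ps → Triangular ps × length ps ≡ m × All (λ p → col p ∈ S) ps
  independent⇒triangular zero    S ind ∣S∣≡ = [] , tt , refl , []
  independent⇒triangular (suc m) S ind ∣S∣≡
    with coveredOnceRow S ind (∣p∣≡1+m⇒nonempty S ∣S∣≡)
  ... | i , j₀ , j₀∈S′ , i∈j₀ , unique
    with independent⇒triangular m (S - j₀) (λ dep → ind (dependent-mono {H = Ḡ} (p─q⊆p S ⁅ j₀ ⁆) dep))
           (cong ℕ.pred (trans (sym (∣p∣≡1+∣p-x∣ (lookup⇒[]= j₀ S j₀∈S′))) ∣S∣≡))
  ... | ps , tri , len , cols⊆ =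
    ps ++ pivot j₀ i ∷ [] ,
    snoc-triangular ps tri i∈j₀ (All.map i∉others cols⊆) ,
    trans (length-++ ps) (trans (cong (_+ 1) len) (+-comm m 1)) ,
    ++⁺ (All.map (p─q⊆p S _) cols⊆) (lookup⇒[]= j₀ S j₀∈S′ ∷ [])
    where
    i∉others : ∀ {j} → j ∈ S - j₀ → i ∉ star j
    i∉others {j} j∈ i∈j = x∉⁅y⁆⇒x≢y (x∈p─q⇒x∉q S ⁅ j₀ ⁆ j∈)
                            (unique j ([]=⇒lookup (p─q⊆p S _ j∈)) i∈j)

  independent⇒chain : ∀ S → IndependentCols Ḡ S → Chain G ∣ S ∣
  independent⇒chain S ind with independent⇒triangular ∣ S ∣ S ind refl
  ... | ps , tri , len , _ =
    subst (Chain G) len (proj₁ (triangular⇒chain ps tri ⊥ ([] , refl) (All.universal (λ _ → ∉⊥) ps)))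

  chain⇒independent : Chain G k → ∃ λ S → IndependentCols Ḡ S × ∣ S ∣ ≡ k
  chain⇒independent C with chain⇒triangular C
  ... | ps , tri , len , _ =
    columns ps , triangular⇒independent ps tri , trans (∣columns∣≡length ps tri) len

theorem9p4 : ∀ (n : ℕ) (G : Graph n) →
    Σ ℕ (λ k → IsCRk (complement G) k × IsHeightUnionLattice G k)
theorem9p4 n G with c-rk-exists (complement G)
... | k , crk@((S , ind , ∣S∣≡k) , maximal) = k , crk , longestChain , chainsBounded
  where
  longestChain : Chain G k
  longestChain = subst (Chain G) ∣S∣≡k (independent⇒chain G S ind)

  chainsBounded : ∀ m → Chain G m → m ≤ k
  chainsBounded m C with chain⇒independent G C
  ... | S′ , ind′ , ∣S′∣≡m = subst (_≤ k) ∣S′∣≡m (maximal S′ ind′)
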